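{- For all $k\geq 2$ and all $n\geq0$, there is no even involution in $\mathfrak{S}_n$ that contains $132$ exactly once and contains $12\cdots k$ exactly once, and there is no even involution in $\mathfrak{S}_n$ that contains $132$ exactly once and contains $23\cdots k1$ exactly once; that is, $\sum_{n}J^e_{12\cdots k;1}(n)x^n=\sum_n J^e_{23\cdots k1;1}(n)x^n=0$.
   Context: $12\cdots k$ is the identity permutation of length $k$ and $23\cdots k1$ is the permutation $(2,3,\dots,k,1)$. An occurrence of a pattern $\tau\in\mathfrak{S}_m$ in $\pi\in\mathfrak{S}_n$ is an index set $i_1<\dots<i_m$ with $\pi_{i_1}\cdots\pi_{i_m}$ order-isomorphic to $\tau$. $J^e_{\tau;r}(n)$ is the number of even involutions $\pi\in\mathfrak{S}_n$ ($\pi=\pi^{ -1}$ with an even number of inversions, pairs $i<j$ with $\pi_i>\pi_j$) containing $132$ exactly once and $\tau$ exactly $r$ times. -}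

module Defs where

open import Data.Nat using (ℕ; zero; suc; _∸_; s≤s) renaming (_<?_ to _<ℕ?_)
open import Data.Nat.Divisibility using (_∣_)
open import Data.Fin using (Fin; zero; suc; toℕ; fromℕ<; _<?_)
open import Data.Vec using (Vec; []; _∷_; lookup)
import Data.Vec as Vec
open import Data.List using (List; []; _∷_; _++_; map; length; filterᵇ; allFin; cartesianProduct)
open import Data.Bool.ListAction using (and)
open import Data.Bool using (Bool; true; false; _∧_; not)
open import Data.Product using (_,_; proj₁; proj₂)
open import Relation.Nullary using (yes; no)
open import Relation.Nullary.Decidable using (⌊_⌋)
open import Relation.Binary.PropositionalEquality using (_≡_)
open import Function using (_∘_; id)

-- A permutation of [n] = {0,…,n-1} is a function Fin n → Fin n.
-- An involution: π ∘ π = id (this already makes π a bijection).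
IsInvolution : ∀ {n} → (Fin n → Fin n) → Set
IsInvolution π = ∀ i → π (π i) ≡ i

pairs : ∀ n → List (Fin n Data.Product.× Fin n)
pairs n = cartesianProduct (allFin n) (allFin n)

inversions : ∀ {n} → (Fin n → Fin n) → ℕ
inversions {n} π =
  length (filterᵇ (λ p → ⌊ proj₁ p <? proj₂ p ⌋ ∧ ⌊ π (proj₂ p) <? π (proj₁ p) ⌋) (pairs n))

IsEven : ℕ → Set
IsEven m = 2 ∣ m

increasing : (m n : ℕ) → List (Vec (Fin n) m)
increasing zero    n       = [] ∷ []
increasing (suc m) zero    = []
increasing (suc m) (suc n) =
  map (λ v → zero ∷ Vec.map suc v) (increasing m n) ++ map (Vec.map suc) (increasing (suc m) n)

_==_ : Bool → Bool → Bool
true  == b = b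
false == b = not b

orderIso : ∀ {m n} → (Fin m → Fin n) → (Fin m → Fin m) → Bool
orderIso {m} f τ = and (map (λ p → ⌊ f (proj₁ p) <? f (proj₂ p) ⌋ == ⌊ τ (proj₁ p) <? τ (proj₂ p) ⌋) (pairs m))

occurrences : ∀ {m n} → (Fin m → Fin m) → (Fin n → Fin n) → ℕ
occurrences {m} {n} τ π = length (filterᵇ (λ v → orderIso (π ∘ lookup v) τ) (increasing m n))

p132 : Fin 3 → Fin 3
p132 zero = zero
p132 (suc zero) = suc (suc zero)
p132 (suc (suc zero)) = suc zero

idPat : (k : ℕ) → Fin k → Fin k
idPat k = id

-- the pattern 23⋯k1: position i (0-indexed) ↦ i+1 for i < k-1, and k-1 ↦ 0
cycPat : (k : ℕ) → Fin k → Fin k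
cycPat zero ()
cycPat (suc j) i with toℕ i <ℕ? j
... | yes p = fromℕ< (s≤s p)
... | no _  = zero

-- Let an involution π contain 132 exactly once, at positions i < j < l.  Since π maps
-- this occurrence to the one at (π i, π l, π j), it fixes i and swaps j and l; and every
-- fixed point y above j lies above l, as otherwise (i, j, y) would be a second 132.
-- For 12⋯k, the image under π of the unique occurrence is again an occurrence, so it
-- consists of fixed points, and putting j in place of the suitable one gives a second
-- occurrence.  For k = 2, the occurrences of 21 are the inversions, whose number is even.
-- For 23⋯k1 with k ≥ 3, write the occurrence as a chain p₁ < ⋯ < pₖ followed by z, and
-- w = π z.  Comparing p₁ with w, then the values π pₐ with z and with pₖ, every case
-- exhibits either a second occurrence (with z moved, p₁ replaced by w, or j inserted into
-- a chain of fixed points) or two different 132s.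
module Submission where

open import Defs
open import Data.Nat using (ℕ; _≤_; zero; suc; z≤n; s≤s; s<s⁻¹)
  renaming (_<_ to _<ℕ_; _<?_ to _<ℕ?_)
import Data.Nat.Properties as ℕ
open import Data.Nat.Divisibility using (_∣_; ∣1⇒≡1)
open import Data.Fin using (Fin; zero; suc; toℕ; fromℕ; inject₁; _<_; _<?_)
  renaming (_≤_ to _≤ᶠ_)
import Data.Fin.Properties as Fin
open import Data.Fin.Relation.Unary.Top using (view; ‵fromℕ; ‵inject₁)
open import Data.Vec using (Vec; []; _∷_; lookup; tabulate)
import Data.Vec as Vec
import Data.Vec.Properties as Vec
open import Data.Vec.Functional using (updateAt)
open import Data.Vec.Functional.Properties
  using (updateAt-updates; updateAt-minimal; map-updateAt-local)
open import Data.List using (List; []; _∷_; map; length; filterᵇ)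
open import Data.List.Membership.Propositional using (_∈_)
open import Data.List.Membership.Propositional.Properties
  using (∈-map⁺; ∈-map⁻; ∈-++⁺ˡ; ∈-++⁺ʳ; ∈-++⁻; ∈-filter⁺; ∈-filter⁻; ∈-cartesianProduct⁺; ∈-allFin)
open import Data.List.Relation.Unary.Any using (here; there)
import Data.List.Relation.Unary.All as All
open All using (_∷_)
open import Data.List.Relation.Unary.All.Properties using (all⁺; all⁻)
open import Data.List.Relation.Unary.AllPairs using (_∷_)
open import Data.List.Relation.Unary.Unique.Propositional using (Unique)
import Data.List.Relation.Unary.Unique.Propositional.Properties as Unique
open import Data.Bool using (Bool; T; _∧_)
open import Data.Bool.ListAction using (all)
open import Data.Bool.Properties using (T?)
open import Data.Empty using (⊥; ⊥-elim)
open import Data.Product using (_×_; Σ-syntax; ∃-syntax; _,_; proj₁; proj₂; uncurry)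
open import Data.Sum using (inj₁; inj₂)
open import Data.Unit using (tt)
open import Function using (_∘_; const; id)
open import Function.Definitions using (Injective)
open import Relation.Nullary using (¬_; Dec; yes; no)
open import Relation.Nullary.Decidable using (⌊_⌋)
open import Relation.Binary.Core using (_Preserves_⟶_)
open import Relation.Binary.Definitions using (tri<; tri≈; tri>)
open import Relation.Binary.PropositionalEquality
  using (_≡_; _≢_; _≗_; refl; sym; trans; cong; cong₂; subst; subst₂)

private
  variable
    k m n : ℕ

Increasing : (Fin m → Fin n) → Set
Increasing g = g Preserves _<_ ⟶ _<_

Increasing-cong : {f g : Fin m → Fin n} → f ≗ g → Increasing f → Increasing g
Increasing-cong f≗g f↑ {a} {b} a<b = subst₂ _<_ (f≗g a) (f≗g b) (f↑ a<b)

Increasing-reflects : {g : Fin m → Fin n} → Increasing g → ∀ {a b} → g a < g b → a < b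
Increasing-reflects g↑ {a} {b} ga<gb with Fin.<-cmp a b
... | tri< a<b _ _ = a<b
... | tri≈ _ refl _ = ⊥-elim (Fin.<-irrefl refl ga<gb)
... | tri> _ _ b<a = ⊥-elim (Fin.<-asym ga<gb (g↑ b<a))

Increasing⇒monotone : {g : Fin m → Fin n} → Increasing g → ∀ {a b} → a ≤ᶠ b → g a ≤ᶠ g b
Increasing⇒monotone g↑ {a} {b} a≤b with a Fin.≟ b
... | yes refl = ℕ.≤-refl
... | no a≢b   = ℕ.<⇒≤ (g↑ (Fin.≤∧≢⇒< a≤b a≢b))

insertionPoint : {g : Fin (suc m) → Fin n} → Increasing g → (x : Fin n) →
                 Σ[ t ∈ Fin (suc m) ] (∀ s → s < t → g s < x) × (∀ s → t < s → x < g s)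
insertionPoint {g = g} g↑ x with x Fin.≤? g zero
... | yes x≤g₀ = zero , (λ _ ()) , λ _ 0<s → ℕ.≤-<-trans x≤g₀ (g↑ 0<s)
insertionPoint {m = zero}  g↑ x | no _ = zero , (λ _ ()) , λ { zero () }
insertionPoint {m = suc m} {g = g} g↑ x | no x≰g₀ with insertionPoint (λ p → g↑ (s≤s p)) x
... | t , below , above = suc t , below′ , above′
  where
  below′ : ∀ s → s < suc t → g s < x
  below′ zero    _       = ℕ.≰⇒> x≰g₀
  below′ (suc s) (s≤s p) = below s p
  above′ : ∀ s → suc t < s → x < g s
  above′ (suc s) (s≤s p) = above s p

updateAt-elim : {A : Set} {g : Fin m → A} {t : Fin m} {x : A} (P : A → Set) →
                P x → (∀ s → s ≢ t → P (g s)) → ∀ s → P (updateAt g t (const x) s)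
updateAt-elim {g = g} {t} P Px Pg s with s Fin.≟ t
... | yes refl = subst P (sym (updateAt-updates s g)) Px
... | no s≢t   = subst P (sym (updateAt-minimal s t g s≢t)) (Pg s s≢t)

updateAt-increasing : {g : Fin m → Fin n} {t : Fin m} {x : Fin n} → Increasing g →
                      (∀ s → s < t → g s < x) → (∀ s → t < s → x < g s) →
                      Increasing (updateAt g t (const x))
updateAt-increasing {g = g} {t} g↑ below above {a} {b} a<b with a Fin.≟ t | b Fin.≟ t
... | yes refl | yes refl = ⊥-elim (Fin.<-irrefl refl a<b)
... | yes refl | no b≢t   =
  subst₂ _<_ (sym (updateAt-updates a g)) (sym (updateAt-minimal b a g b≢t)) (above b a<b)
... | no a≢t   | yes refl =
  subst₂ _<_ (sym (updateAt-minimal a b g a≢t)) (sym (updateAt-updates b g)) (below a a<b)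
... | no a≢t   | no b≢t   =
  subst₂ _<_ (sym (updateAt-minimal a t g a≢t)) (sym (updateAt-minimal b t g b≢t)) (g↑ a<b)

lookup-map-suc< : (w : Vec (Fin n) m) → ∀ {a b} → lookup w a < lookup w b →
                  lookup (Vec.map suc w) a < lookup (Vec.map suc w) b
lookup-map-suc< w {a} {b} p =
  subst₂ _<_ (sym (Vec.lookup-map a suc w)) (sym (Vec.lookup-map b suc w)) (s≤s p)

lookup-map-suc<⁻ : (w : Vec (Fin n) m) → ∀ {a b} →
                   lookup (Vec.map suc w) a < lookup (Vec.map suc w) b → lookup w a < lookup w b
lookup-map-suc<⁻ w {a} {b} p =
  s<s⁻¹ (subst₂ _<_ (Vec.lookup-map a suc w) (Vec.lookup-map b suc w) p)

zero∷map-suc-increasing : (w : Vec (Fin n) m) → Increasing (lookup w) →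
                          Increasing (lookup (zero ∷ Vec.map suc w))
zero∷map-suc-increasing {n = n} w w↑ {zero}  {suc b} _       =
  subst (zero {n} <_) (sym (Vec.lookup-map b suc w)) (s≤s z≤n)
zero∷map-suc-increasing         w w↑ {suc a} {suc b} (s≤s p) = lookup-map-suc< w (w↑ p)

positive⇒map-suc : (v : Vec (Fin (suc n)) m) → (∀ a → zero {n} < lookup v a) →
                   ∃[ w ] v ≡ Vec.map suc w
positive⇒map-suc []          _   = [] , refl
positive⇒map-suc (zero ∷ v)  pos with () ← pos zero
positive⇒map-suc (suc x ∷ v) pos with positive⇒map-suc v (pos ∘ suc)
... | w , refl = x ∷ w , refl

∈-increasing⁻ : {v : Vec (Fin n) m} → v ∈ increasing m n → Increasing (lookup v)
∈-increasing⁻ {m = zero} {v = []} _ {()}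
∈-increasing⁻ {n = zero} {m = suc m} ()
∈-increasing⁻ {n = suc n} {m = suc m} v∈
  with ∈-++⁻ (map (λ w → zero ∷ Vec.map suc w) (increasing m n)) v∈
... | inj₁ v∈ˡ with ∈-map⁻ (λ w → zero ∷ Vec.map suc w) v∈ˡ
...   | w , w∈ , refl = zero∷map-suc-increasing w (∈-increasing⁻ w∈)
∈-increasing⁻ {n = suc n} {m = suc m} v∈ | inj₂ v∈ʳ with ∈-map⁻ (Vec.map suc) v∈ʳ
...   | w , w∈ , refl = lookup-map-suc< w ∘ ∈-increasing⁻ w∈

∈-increasing⁺ : (v : Vec (Fin n) m) → Increasing (lookup v) → v ∈ increasing m n
∈-increasing⁺ {m = zero}          []       _  = here refl
∈-increasing⁺ {n = suc n} {m = suc m} (zero ∷ v) v↑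
  with positive⇒map-suc v (λ a → v↑ {zero} {suc a} (s≤s z≤n))
... | w , refl = ∈-++⁺ˡ (∈-map⁺ (λ w → zero ∷ Vec.map suc w)
                   (∈-increasing⁺ w (λ p → lookup-map-suc<⁻ w (v↑ (s≤s p)))))
∈-increasing⁺ {n = suc n} {m = suc m} (suc x ∷ v) v↑
  with positive⇒map-suc v (λ a → ℕ.<-trans (s≤s z≤n) (v↑ {zero} {suc a} (s≤s z≤n)))
... | w , refl = ∈-++⁺ʳ (map (λ w → zero ∷ Vec.map suc w) (increasing m n))
                   (∈-map⁺ (Vec.map suc)
                     (∈-increasing⁺ (x ∷ w) λ {a} {b} p → lookup-map-suc<⁻ (x ∷ w) {a} {b} (v↑ p)))

module _ {P Q : Set} where

  T-⌊⌋==⌊⌋⁻ : (p : Dec P) (q : Dec Q) → T (⌊ p ⌋ == ⌊ q ⌋) → Q → P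
  T-⌊⌋==⌊⌋⁻ (yes x) _       _  _ = x
  T-⌊⌋==⌊⌋⁻ (no _)  (no ¬y) _  y = ⊥-elim (¬y y)

  T-⌊⌋==⌊⌋⁺ : (p : Dec P) (q : Dec Q) → (P → Q) → (Q → P) → T (⌊ p ⌋ == ⌊ q ⌋)
  T-⌊⌋==⌊⌋⁺ (yes _) (yes _) _   _   = tt
  T-⌊⌋==⌊⌋⁺ (yes x) (no ¬y) P⇒Q _   = ¬y (P⇒Q x)
  T-⌊⌋==⌊⌋⁺ (no ¬x) (yes y) _   Q⇒P = ¬x (Q⇒P y)
  T-⌊⌋==⌊⌋⁺ (no _)  (no _)  _   _   = tt

T-all-pairs⁻ : (h : Fin m × Fin m → Bool) → T (all h (pairs m)) → ∀ a b → T (h (a , b))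
T-all-pairs⁻ {m = m} h all-h a b =
  All.lookup (all⁺ h (pairs m) all-h) (∈-cartesianProduct⁺ (∈-allFin a) (∈-allFin b))

T-all-pairs⁺ : (h : Fin m × Fin m → Bool) → (∀ a b → T (h (a , b))) → T (all h (pairs m))
T-all-pairs⁺ {m = m} h h-holds = all⁻ h {pairs m} (All.tabulate λ {(a , b)} _ → h-holds a b)

module _ {f : Fin m → Fin n} {τ : Fin m → Fin m} where

  orderIso⇒follows : T (orderIso f τ) → ∀ {a b} → τ a < τ b → f a < f b
  orderIso⇒follows iso {a} {b} =
    T-⌊⌋==⌊⌋⁻ (f a <? f b) (τ a <? τ b) (T-all-pairs⁻ _ iso a b)

  follows⇒orderIso : Injective _≡_ _≡_ τ → (∀ {a b} → τ a < τ b → f a < f b) → T (orderIso f τ)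
  follows⇒orderIso τ-inj follows = T-all-pairs⁺ _ λ a b →
    T-⌊⌋==⌊⌋⁺ (f a <? f b) (τ a <? τ b) (reflects a b) follows
    where
    reflects : ∀ a b → f a < f b → τ a < τ b
    reflects a b fa<fb with Fin.<-cmp (τ a) (τ b)
    ... | tri< τa<τb _ _ = τa<τb
    ... | tri≈ _ τa≡τb _ = ⊥-elim (Fin.<-irrefl (cong f (τ-inj τa≡τb)) fa<fb)
    ... | tri> _ _ τb<τa = ⊥-elim (Fin.<-asym fa<fb (follows τb<τa))

-- For injective τ this is order-isomorphism of π ∘ g with τ (follows⇒orderIso).
record Occurrence (τ : Fin m → Fin m) (π : Fin n → Fin n) (g : Fin m → Fin n) : Set where
  field
    ascending : Increasing g
    ordered   : ∀ {a b} → τ a < τ b → π (g a) < π (g b)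

Occurrence-cong : {τ : Fin m → Fin m} {π : Fin n → Fin n} {g h : Fin m → Fin n} →
                  g ≗ h → Occurrence τ π g → Occurrence τ π h
Occurrence-cong {π = π} g≗h occ = record
  { ascending = Increasing-cong g≗h ascending
  ; ordered   = λ {a} {b} τa<τb → subst₂ _<_ (cong π (g≗h a)) (cong π (g≗h b)) (ordered τa<τb)
  }
  where open Occurrence occ

record UniqueOccurrence (τ : Fin m → Fin m) (π : Fin n → Fin n) : Set where
  field
    positions : Fin m → Fin n
    occurs    : Occurrence τ π positions
    unique    : ∀ {g} → Occurrence τ π g → g ≗ positions

length≡1⇒singleton : {A : Set} (xs : List A) → length xs ≡ 1 → ∃[ x ] xs ≡ x ∷ []
length≡1⇒singleton (x ∷ []) _ = x , refl

module _ {τ : Fin m → Fin m} {π : Fin n → Fin n} where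

  private
    occursAt : Vec (Fin n) m → Bool
    occursAt v = orderIso (π ∘ lookup v) τ

  ∈-occurrences⁻ : {v : Vec (Fin n) m} → v ∈ filterᵇ occursAt (increasing m n) →
                   Occurrence τ π (lookup v)
  ∈-occurrences⁻ {v} v∈ = record
    { ascending = ∈-increasing⁻ (proj₁ v∈′)
    ; ordered   = orderIso⇒follows {f = π ∘ lookup v} (proj₂ v∈′)
    }
    where v∈′ = ∈-filter⁻ (T? ∘ occursAt) v∈

  ∈-occurrences⁺ : Injective _≡_ _≡_ τ → {v : Vec (Fin n) m} → Occurrence τ π (lookup v) →
                   v ∈ filterᵇ occursAt (increasing m n)
  ∈-occurrences⁺ τ-inj {v} occ =
    ∈-filter⁺ (T? ∘ occursAt) (∈-increasing⁺ v ascending) (follows⇒orderIso τ-inj ordered)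
    where open Occurrence occ

  occurrences≡1⇒unique : Injective _≡_ _≡_ τ → occurrences τ π ≡ 1 → UniqueOccurrence τ π
  occurrences≡1⇒unique τ-inj once
    with length≡1⇒singleton (filterᵇ occursAt (increasing m n)) once
  ... | v , only-v = record
    { positions = lookup v
    ; occurs    = ∈-occurrences⁻ (subst (v ∈_) (sym only-v) (here refl))
    ; unique    = unique
    }
    where
    unique : ∀ {g} → Occurrence τ π g → g ≗ lookup v
    unique {g} occ a
      with subst (tabulate g ∈_) only-v
             (∈-occurrences⁺ τ-inj (Occurrence-cong (sym ∘ Vec.lookup∘tabulate g) occ))
    ... | here tabulate-g≡v =
      trans (sym (Vec.lookup∘tabulate g a)) (cong (λ w → lookup w a) tabulate-g≡v)

involution⇒injective : {π : Fin n → Fin n} → IsInvolution π → Injective _≡_ _≡_ π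
involution⇒injective {π = π} inv {a} {b} πa≡πb = trans (sym (inv a)) (trans (cong π πa≡πb) (inv b))

involution-flip : {π : Fin n → Fin n} → IsInvolution π → ∀ {x y} → π x ≡ y → π y ≡ x
involution-flip {π = π} inv {x} πx≡y = trans (cong π (sym πx≡y)) (inv x)

p132-involution : IsInvolution p132
p132-involution zero             = refl
p132-involution (suc zero)       = refl
p132-involution (suc (suc zero)) = refl

Is132 : (Fin n → Fin n) → Fin n → Fin n → Fin n → Set
Is132 π x y z = x < y × y < z × π x < π z × π z < π y

module _ {π : Fin n → Fin n} where

  occurrence⇒Is132 : {g : Fin 3 → Fin n} → Occurrence p132 π g →
                     Is132 π (g zero) (g (suc zero)) (g (suc (suc zero)))
  occurrence⇒Is132 occ =
    ascending (s≤s z≤n) , ascending (s≤s (s≤s z≤n)) ,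
    ordered {zero} {suc (suc zero)} (s≤s z≤n) , ordered {suc (suc zero)} {suc zero} (s≤s (s≤s z≤n))
    where open Occurrence occ

  Is132⇒occurrence : ∀ {x y z} → Is132 π x y z → Occurrence p132 π (lookup (x ∷ y ∷ z ∷ []))
  Is132⇒occurrence {x} {y} {z} (x<y , y<z , πx<πz , πz<πy) =
    record { ascending = ascending ; ordered = ordered }
    where
    g = lookup (x ∷ y ∷ z ∷ [])
    ascending : Increasing g
    ascending {zero}       {suc zero}       _ = x<y
    ascending {zero}       {suc (suc zero)} _ = Fin.<-trans x<y y<z
    ascending {suc zero}   {suc (suc zero)} _ = y<z
    ascending {suc zero}       {suc zero}       (s≤s ())
    ascending {suc (suc zero)} {suc (suc zero)} (s≤s (s≤s ()))
    ascending {suc (suc zero)} {suc zero}       (s≤s ())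
    ordered : ∀ {a b} → p132 a < p132 b → π (g a) < π (g b)
    ordered {zero}           {suc zero}       _ = Fin.<-trans πx<πz πz<πy
    ordered {zero}           {suc (suc zero)} _ = πx<πz
    ordered {suc (suc zero)} {suc zero}       _ = πz<πy
    ordered {suc zero}       {suc zero}       (s≤s (s≤s ()))
    ordered {suc zero}       {suc (suc zero)} (s≤s ())
    ordered {suc (suc zero)} {suc (suc zero)} (s≤s ())

record Unique132 (π : Fin n → Fin n) : Set where
  field
    i j l  : Fin n
    is132  : Is132 π i j l
    unique : ∀ {x y z} → Is132 π x y z → x ≡ i × y ≡ j × z ≡ l

occurrences≡1⇒Unique132 : {π : Fin n → Fin n} → occurrences p132 π ≡ 1 → Unique132 π
occurrences≡1⇒Unique132 {π = π} once = record
  { i      = g zero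
  ; j      = g (suc zero)
  ; l      = g (suc (suc zero))
  ; is132  = occurrence⇒Is132 occurs
  ; unique = λ x-y-z → let same = unique (Is132⇒occurrence x-y-z) in
                       same zero , same (suc zero) , same (suc (suc zero))
  }
  where
  p132-injective = involution⇒injective {π = p132} p132-involution
  open UniqueOccurrence (occurrences≡1⇒unique {τ = p132} {π = π} p132-injective once)
    renaming (positions to g)

module Involution132 {π : Fin n → Fin n} (inv : IsInvolution π) (U : Unique132 π) where
  open Unique132 U public

  i<j : i < j
  i<j = proj₁ is132

  j<l : j < l
  j<l = proj₁ (proj₂ is132)

  -- π carries the 132 at (i, j, l) to one at (π i, π l, π j), so the two coincide.
  private
    mirror = unique {π i} {π l} {π j}
      ( proj₁ (proj₂ (proj₂ is132)) , proj₂ (proj₂ (proj₂ is132))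
      , subst₂ _<_ (sym (inv i)) (sym (inv j)) i<j , subst₂ _<_ (sym (inv j)) (sym (inv l)) j<l )

  πi≡i : π i ≡ i
  πi≡i = proj₁ mirror

  πj≡l : π j ≡ l
  πj≡l = proj₂ (proj₂ mirror)

  πl≡j : π l ≡ j
  πl≡j = proj₁ (proj₂ mirror)

  π-flip : ∀ {x y} → π x ≡ y → π y ≡ x
  π-flip = involution-flip {π = π} inv

  fixed⇒≢j : ∀ {x} → π x ≡ x → x ≢ j
  fixed⇒≢j πj≡j refl = Fin.<⇒≢ j<l (trans (sym πj≡j) πj≡l)

  fixed-above-j⇒above-l : ∀ {y} → π y ≡ y → j < y → l < y
  fixed-above-j⇒above-l {y} πy≡y j<y with Fin.<-cmp l y
  ... | tri< l<y _ _ = l<y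
  ... | tri≈ _ refl _ = ⊥-elim (Fin.<⇒≢ j<l (trans (sym πl≡j) πy≡y))
  ... | tri> _ _ y<l = ⊥-elim (Fin.<⇒≢ y<l (proj₂ (proj₂ (unique 132-at-y))))
    where
    132-at-y : Is132 π i j y
    132-at-y = i<j , j<y , subst₂ _<_ (sym πi≡i) (sym πy≡y) (Fin.<-trans i<j j<y)
                         , subst₂ _<_ (sym πy≡y) (sym πj≡l) y<l

  insert-j : {g : Fin (suc k) → Fin n} → Increasing g → (∀ s → π (g s) ≡ g s) →
             Σ[ t ∈ Fin (suc k) ] Increasing (updateAt g t (const j))
                                × Increasing (π ∘ updateAt g t (const j))
  insert-j {g = g} g↑ fixed with insertionPoint g↑ j
  ... | t , below , above =
    t , updateAt-increasing g↑ below above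
      , Increasing-cong (sym ∘ map-updateAt-local {f = π} {g = const j} g t πj≡l)
          (updateAt-increasing (Increasing-cong (sym ∘ fixed) g↑)
            (λ s s<t → subst (_< l) (sym (fixed s)) (Fin.<-trans (below s s<t) j<l))
            (λ s t<s → subst (l <_) (sym (fixed s))
                                  (fixed-above-j⇒above-l (fixed s) (above s t<s))))

¬UniqueOccurrence-idPat : {π : Fin n → Fin n} → IsInvolution π → Unique132 π →
                       ¬ UniqueOccurrence (idPat (suc k)) π
¬UniqueOccurrence-idPat {π = π} inv U uo = fixed⇒≢j (fixed t) (sym j≡g-t)
  where
  open Involution132 inv U
  open UniqueOccurrence uo renaming (positions to g; unique to g-unique)
  open Occurrence occurs

  fixed : ∀ s → π (g s) ≡ g s
  fixed = g-unique (record
    { ascending = ordered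
    ; ordered   = Increasing-cong (sym ∘ inv ∘ g) ascending
    })

  inserted = insert-j ascending fixed
  t = proj₁ inserted

  j≡g-t : j ≡ g t
  j≡g-t = trans (sym (updateAt-updates t g)) (g-unique (record
    { ascending = proj₁ (proj₂ inserted)
    ; ordered   = proj₂ (proj₂ inserted)
    }) t)

snoc : {A : Set} → (Fin k → A) → A → Fin (suc k) → A
snoc {k = zero}  ch z zero    = z
snoc {k = suc k} ch z zero    = ch zero
snoc {k = suc k} ch z (suc a) = snoc (ch ∘ suc) z a

snoc-inject₁ : {A : Set} (ch : Fin k → A) (z : A) (a : Fin k) → snoc ch z (inject₁ a) ≡ ch a
snoc-inject₁ {k = suc k} ch z zero    = refl
snoc-inject₁ {k = suc k} ch z (suc a) = snoc-inject₁ (ch ∘ suc) z a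

snoc-fromℕ : {A : Set} (ch : Fin k → A) (z : A) → snoc ch z (fromℕ k) ≡ z
snoc-fromℕ {k = zero}  ch z = refl
snoc-fromℕ {k = suc k} ch z = snoc-fromℕ (ch ∘ suc) z

inject₁<fromℕ : (a : Fin k) → inject₁ a < fromℕ k
inject₁<fromℕ zero    = s≤s z≤n
inject₁<fromℕ (suc a) = s≤s (inject₁<fromℕ a)

inject₁-mono-< : {a b : Fin k} → a < b → inject₁ a < inject₁ b
inject₁-mono-< {a = a} {b} = subst₂ _<ℕ_ (sym (Fin.toℕ-inject₁ a)) (sym (Fin.toℕ-inject₁ b))

fromℕ≮ : (b : Fin (suc k)) → ¬ fromℕ k < b
fromℕ≮ b last<b = ℕ.<⇒≱ last<b (Fin.≤fromℕ b)

cycPat-inject₁ : (a : Fin k) → toℕ (cycPat (suc k) (inject₁ a)) ≡ suc (toℕ a)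
cycPat-inject₁ {k} a with toℕ (inject₁ a) <ℕ? k
... | yes p = trans (Fin.toℕ-fromℕ< (s≤s p)) (cong suc (Fin.toℕ-inject₁ a))
... | no ¬p = ⊥-elim (¬p (Fin.inject₁ℕ< a))

cycPat-fromℕ : cycPat (suc k) (fromℕ k) ≡ zero
cycPat-fromℕ {k} with toℕ (fromℕ k) <ℕ? k
... | yes p = ⊥-elim (ℕ.<-irrefl (Fin.toℕ-fromℕ k) p)
... | no _  = refl

cycPat-injective : Injective _≡_ _≡_ (cycPat (suc k))
cycPat-injective {x = a} {b} τa≡τb with view a | view b
... | ‵fromℕ      | ‵fromℕ      = refl
... | ‵fromℕ      | ‵inject₁ b′
  with () ← trans (cong toℕ (trans (sym cycPat-fromℕ) τa≡τb)) (cycPat-inject₁ b′)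
... | ‵inject₁ a′ | ‵fromℕ
  with () ← trans (sym (cycPat-inject₁ a′)) (cong toℕ (trans τa≡τb cycPat-fromℕ))
... | ‵inject₁ a′ | ‵inject₁ b′ = cong inject₁ (Fin.toℕ-injective (ℕ.suc-injective
        (trans (sym (cycPat-inject₁ a′)) (trans (cong toℕ τa≡τb) (cycPat-inject₁ b′)))))

-- An occurrence of 23⋯(k+1)1, split into its first k entries and its last one.
record CycOccurrence (π : Fin n → Fin n) (ch : Fin k → Fin n) (z : Fin n) : Set where
  field
    chain-ascending : Increasing ch
    chain-ordered   : Increasing (π ∘ ch)
    before-last     : ∀ a → ch a < z
    last-smallest   : ∀ a → π z < π (ch a)

CycOccurrence-cong : {π : Fin n → Fin n} {ch ch′ : Fin k → Fin n} {z z′ : Fin n} →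
                     ch ≗ ch′ → z ≡ z′ → CycOccurrence π ch z → CycOccurrence π ch′ z′
CycOccurrence-cong {π = π} {z = z} ch≗ch′ refl cyc = record
  { chain-ascending = Increasing-cong ch≗ch′ chain-ascending
  ; chain-ordered   = Increasing-cong (cong π ∘ ch≗ch′) chain-ordered
  ; before-last     = λ a → subst (_< z) (ch≗ch′ a) (before-last a)
  ; last-smallest   = λ a → subst (π z <_) (cong π (ch≗ch′ a)) (last-smallest a)
  }
  where open CycOccurrence cyc

module _ {π : Fin n → Fin n} {g : Fin (suc k) → Fin n} where

  occurrence⇒CycOccurrence : Occurrence (cycPat (suc k)) π g →
                             CycOccurrence π (g ∘ inject₁) (g (fromℕ k))
  occurrence⇒CycOccurrence occ = record
    { chain-ascending = ascending ∘ inject₁-mono-<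
    ; chain-ordered   = λ {a} {b} a<b → ordered
        (subst₂ _<ℕ_ (sym (cycPat-inject₁ a)) (sym (cycPat-inject₁ b)) (s≤s a<b))
    ; before-last     = λ a → ascending (inject₁<fromℕ a)
    ; last-smallest   = λ a → ordered
        (Fin.<-respˡ-≡ (sym cycPat-fromℕ) (subst (0 <ℕ_) (sym (cycPat-inject₁ a)) (s≤s z≤n)))
    }
    where open Occurrence occ

  CycOccurrence⇒occurrence : CycOccurrence π (g ∘ inject₁) (g (fromℕ k)) →
                             Occurrence (cycPat (suc k)) π g
  CycOccurrence⇒occurrence cyc = record { ascending = ascending ; ordered = ordered }
    where
    open CycOccurrence cyc
    ascending : Increasing g
    ascending {a} {b} a<b with view a | view b
    ... | ‵inject₁ a′ | ‵inject₁ b′ =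
      chain-ascending (subst₂ _<ℕ_ (Fin.toℕ-inject₁ a′) (Fin.toℕ-inject₁ b′) a<b)
    ... | ‵inject₁ a′ | ‵fromℕ      = before-last a′
    ... | ‵fromℕ      | _           = ⊥-elim (fromℕ≮ b a<b)
    ordered : ∀ {a b} → cycPat (suc k) a < cycPat (suc k) b → π (g a) < π (g b)
    ordered {a} {b} τa<τb with view a | view b
    ... | ‵inject₁ a′ | ‵inject₁ b′ =
      chain-ordered (s<s⁻¹ (subst₂ _<ℕ_ (cycPat-inject₁ a′) (cycPat-inject₁ b′) τa<τb))
    ... | ‵inject₁ _  | ‵fromℕ      = ⊥-elim (ℕ.n≮0 (Fin.<-respʳ-≡ cycPat-fromℕ τa<τb))
    ... | ‵fromℕ      | ‵inject₁ b′ = last-smallest b′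
    ... | ‵fromℕ      | ‵fromℕ      = ⊥-elim (Fin.<-irrefl refl τa<τb)

record UniqueCycOccurrence (π : Fin n → Fin n) (k : ℕ) : Set where
  field
    chain  : Fin k → Fin n
    last   : Fin n
    occurs : CycOccurrence π chain last
    unique : ∀ {ch z} → CycOccurrence π ch z → ch ≗ chain × z ≡ last

occurrences≡1⇒UniqueCycOccurrence : {π : Fin n → Fin n} → occurrences (cycPat (suc k)) π ≡ 1 →
                                    UniqueCycOccurrence π k
occurrences≡1⇒UniqueCycOccurrence {k = k} {π = π} once = record
  { chain  = g ∘ inject₁
  ; last   = g (fromℕ k)
  ; occurs = occurrence⇒CycOccurrence occurs
  ; unique = λ {ch} {z} cyc →
      let same = unique (CycOccurrence⇒occurrence {g = snoc ch z}
                   (CycOccurrence-cong (sym ∘ snoc-inject₁ ch z) (sym (snoc-fromℕ ch z)) cyc))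
      in (λ a → trans (sym (snoc-inject₁ ch z a)) (same (inject₁ a))) ,
         trans (sym (snoc-fromℕ ch z)) (same (fromℕ k))
  }
  where
  open UniqueOccurrence (occurrences≡1⇒unique {τ = cycPat (suc k)} {π = π} cycPat-injective once)
    renaming (positions to g)

even-length⇒two-distinct : {A : Set} {xs : List A} {x : A} → Unique xs → 2 ∣ length xs → x ∈ xs →
                           Σ[ y ∈ A ] Σ[ z ∈ A ] y ∈ xs × z ∈ xs × y ≢ z
even-length⇒two-distinct {xs = _ ∷ []}    _               2∣1 _ with () ← ∣1⇒≡1 2∣1
even-length⇒two-distinct {xs = y ∷ z ∷ _} ((y≢z ∷ _) ∷ _) _   _ =
  y , z , here refl , there (here refl) , y≢z

inversion⇒CycOccurrence : {π : Fin n → Fin n} {a b : Fin n} → a < b → π b < π a →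
                          CycOccurrence π (λ (_ : Fin 1) → a) b
inversion⇒CycOccurrence a<b πb<πa = record
  { chain-ascending = λ { {zero} {zero} () }
  ; chain-ordered   = λ { {zero} {zero} () }
  ; before-last     = λ _ → a<b
  ; last-smallest   = λ _ → πb<πa
  }

even-inversions⇒¬UniqueCycOccurrence₁ : {π : Fin n → Fin n} → IsEven (inversions π) →
                                        ¬ UniqueCycOccurrence π 1
even-inversions⇒¬UniqueCycOccurrence₁ {n} {π} even uc =
  let _ , _ , y∈ , z∈ , y≢z = even-length⇒two-distinct unique-inversions even occurrence∈
  in y≢z (trans (inversion≡occurrence y∈) (sym (inversion≡occurrence z∈)))
  where
  open UniqueCycOccurrence uc
  open CycOccurrence occurs

  isInversion : Fin n × Fin n → Bool
  isInversion p = ⌊ proj₁ p <? proj₂ p ⌋ ∧ ⌊ π (proj₂ p) <? π (proj₁ p) ⌋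

  unique-inversions : Unique (filterᵇ isInversion (pairs n))
  unique-inversions = Unique.filter⁺ (T? ∘ isInversion)
                        (Unique.cartesianProduct⁺ (Unique.allFin⁺ n) (Unique.allFin⁺ n))

  isInversion⁻ : ∀ {a b} → T (isInversion (a , b)) → a < b × π b < π a
  isInversion⁻ {a} {b} t with a <? b | π b <? π a
  ... | yes a<b | yes πb<πa = a<b , πb<πa

  isInversion⁺ : ∀ {a b} → a < b → π b < π a → T (isInversion (a , b))
  isInversion⁺ {a} {b} a<b πb<πa with a <? b | π b <? π a
  ... | yes _  | yes _  = tt
  ... | yes _  | no ¬q  = ¬q πb<πa
  ... | no ¬p  | _      = ¬p a<b

  occurrence∈ : (chain zero , last) ∈ filterᵇ isInversion (pairs n)
  occurrence∈ = ∈-filter⁺ (T? ∘ isInversion) (∈-cartesianProduct⁺ (∈-allFin _) (∈-allFin _))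
                          (isInversion⁺ (before-last zero) (last-smallest zero))

  inversion≡occurrence : ∀ {p} → p ∈ filterᵇ isInversion (pairs n) → p ≡ (chain zero , last)
  inversion≡occurrence {a , b} p∈ = cong₂ _,_ (proj₁ same zero) (proj₂ same)
    where
    same = unique (uncurry inversion⇒CycOccurrence
                     (isInversion⁻ (proj₂ (∈-filter⁻ (T? ∘ isInversion) {xs = pairs n} p∈))))

module LongCycOccurrence {π : Fin n → Fin n} (inv : IsInvolution π) (U : Unique132 π)
                 (uc : UniqueCycOccurrence π (suc (suc m))) where
  open Involution132 inv U
  open UniqueCycOccurrence uc renaming (chain to p; last to z; unique to cyc-unique)
  open CycOccurrence occurs

  p₁ p₂ pₖ v₁ v₂ vₖ w : Fin n
  p₁ = p zero
  p₂ = p (suc zero)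
  pₖ = p (fromℕ (suc m))
  v₁ = π p₁
  v₂ = π p₂
  vₖ = π pₖ
  w  = π z

  p₁≤ : ∀ a → p₁ ≤ᶠ p a
  p₁≤ a = Increasing⇒monotone chain-ascending z≤n

  ≤pₖ : ∀ a → p a ≤ᶠ pₖ
  ≤pₖ a = Increasing⇒monotone chain-ascending (Fin.≤fromℕ a)

  v₁≤ : ∀ a → v₁ ≤ᶠ π (p a)
  v₁≤ a = Increasing⇒monotone chain-ordered z≤n

  ≤vₖ : ∀ a → π (p a) ≤ᶠ vₖ
  ≤vₖ a = Increasing⇒monotone chain-ordered (Fin.≤fromℕ a)

  v₂≤ : ∀ a → zero {suc m} < a → v₂ ≤ᶠ π (p a)
  v₂≤ a = Increasing⇒monotone chain-ordered

  p₁<p₂ : p₁ < p₂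
  p₁<p₂ = chain-ascending (s≤s z≤n)

  v₁<v₂ : v₁ < v₂
  v₁<v₂ = chain-ordered (s≤s z≤n)

  pₖ<z : pₖ < z
  pₖ<z = before-last (fromℕ (suc m))

  w<v₁ : w < v₁
  w<v₁ = last-smallest zero

  w<vₖ : w < vₖ
  w<vₖ = last-smallest (fromℕ (suc m))

  w<p₁⇒w<z : w < p₁ → w < z
  w<p₁⇒w<z w<p₁ = Fin.<-trans w<p₁ (before-last zero)

  last-unique : ∀ {z′} → pₖ < z′ → π z′ < v₁ → z′ ≡ z
  last-unique pₖ<z′ πz′<v₁ = proj₂ (cyc-unique (record
    { chain-ascending = chain-ascending
    ; chain-ordered   = chain-ordered
    ; before-last     = λ a → ℕ.≤-<-trans (≤pₖ a) pₖ<z′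
    ; last-smallest   = λ a → ℕ.<-≤-trans πz′<v₁ (v₁≤ a)
    }))

  chain-unique : ∀ {ch} → CycOccurrence π ch z → ch ≗ p
  chain-unique = proj₁ ∘ cyc-unique

  p₁≮w : ¬ p₁ < w
  p₁≮w p₁<w with Fin.<-cmp v₁ pₖ
  ... | tri> _ _ pₖ<v₁ =
    Fin.<-irrefl (sym (π-flip (last-unique pₖ<v₁ πv₁<v₁))) p₁<w
    where πv₁<v₁ = subst (_< v₁) (sym (inv p₁)) (Fin.<-trans p₁<w w<v₁)
  ... | tri≈ _ v₁≡pₖ _ =
    Fin.<-irrefl (sym (π-flip v₁≡pₖ)) (Fin.<-trans p₁<w w<vₖ)
  ... | tri< v₁<pₖ _ _ = Fin.<-irrefl (sym v₁≡p₁) (Fin.<-trans p₁<w w<v₁)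
    where
    132-from-v₁ : Is132 π v₁ pₖ z
    132-from-v₁ = v₁<pₖ , pₖ<z , subst (_< w) (sym (inv p₁)) p₁<w , w<vₖ
    132-from-p₁ : Is132 π p₁ w vₖ
    132-from-p₁ = p₁<w , w<vₖ , subst (v₁ <_) (sym (inv pₖ)) v₁<pₖ
                                , subst₂ _<_ (sym (inv pₖ)) (sym (inv z)) pₖ<z
    v₁≡p₁ = trans (proj₁ (unique 132-from-v₁)) (sym (proj₁ (unique 132-from-p₁)))

  p₁≢w : p₁ ≢ w
  p₁≢w p₁≡w = Fin.<-irrefl (trans v₁≡z (sym v₂≡z)) v₁<v₂
    where
    v₁≡z : v₁ ≡ z
    v₁≡z = trans (cong π p₁≡w) (inv z)
    v₂≡z : v₂ ≡ z
    v₂≡z = last-unique (Fin.<-trans pₖ<z (subst (_< v₂) v₁≡z v₁<v₂))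
                       (subst₂ _<_ (sym (inv p₂)) (sym v₁≡z) (before-last (suc zero)))

  w<z⇒j<z : w < z → j < z
  w<z⇒j<z w<z with Fin.<-cmp j z
  ... | tri< j<z _ _ = j<z
  ... | tri≈ _ j≡z _ =
    ⊥-elim (Fin.<-asym w<z (subst₂ _<_ j≡z (trans (sym πj≡l) (cong π j≡z)) j<l))
  ... | tri> _ _ z<j = ⊥-elim (Fin.<-irrefl (trans (cong π z≡i) (trans πi≡i (sym z≡i))) w<z)
    where
    z≡i = proj₁ (unique (z<j , j<l , subst (w <_) (sym πl≡j) (Fin.<-trans w<z z<j)
                                   , subst₂ _<_ (sym πl≡j) (sym πj≡l) j<l))

  fixed-p₁⇒w<l : w < p₁ → π p₁ ≡ p₁ → w < l
  fixed-p₁⇒w<l w<p₁ πp₁≡p₁ with Fin.<-cmp w l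
  ... | tri< w<l _ _ = w<l
  ... | tri≈ _ w≡l _ =
    ⊥-elim (Fin.<-irrefl (trans (sym πl≡j) (π-flip w≡l)) (w<z⇒j<z (w<p₁⇒w<z w<p₁)))
  ... | tri> _ _ l<w = ⊥-elim (Fin.<⇒≢ i<j (sym (proj₁ (unique 132-at-j))))
    where
    132-at-j : Is132 π j w p₁
    132-at-j = Fin.<-trans j<l l<w , w<p₁
             , subst₂ _<_ (sym πj≡l) (sym πp₁≡p₁) (Fin.<-trans l<w w<p₁)
             , subst₂ _<_ (sym πp₁≡p₁) (sym (inv z)) (before-last zero)

  fixed-chain-impossible : w < p₁ → (∀ a → π (p a) ≡ p a) → ⊥
  fixed-chain-impossible w<p₁ fixed = fixed⇒≢j (fixed t) (sym j≡p-t)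
    where
    inserted = insert-j chain-ascending fixed
    t = proj₁ inserted

    occurrence-with-j : CycOccurrence π (updateAt p t (const j)) z
    occurrence-with-j = record
      { chain-ascending = proj₁ (proj₂ inserted)
      ; chain-ordered   = proj₂ (proj₂ inserted)
      ; before-last     = updateAt-elim {t = t} (_< z) (w<z⇒j<z (w<p₁⇒w<z w<p₁))
                                        (λ s _ → before-last s)
      ; last-smallest   = updateAt-elim {t = t} (λ y → w < π y)
                            (subst (w <_) (sym πj≡l) (fixed-p₁⇒w<l w<p₁ (fixed zero)))
                            (λ s _ → last-smallest s)
      }

    j≡p-t : j ≡ p t
    j≡p-t = trans (sym (updateAt-updates t p)) (chain-unique occurrence-with-j t)

  132-at-p₁ : z < vₖ → v₁ < pₖ → Is132 π p₁ pₖ vₖ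
  132-at-p₁ z<vₖ v₁<pₖ = chain-ascending (s≤s z≤n) , pₖ<vₖ
                       , subst (v₁ <_) (sym (inv pₖ)) v₁<pₖ , subst (_< vₖ) (sym (inv pₖ)) pₖ<vₖ
    where pₖ<vₖ = Fin.<-trans pₖ<z z<vₖ

  below-132 : z < vₖ → v₂ < z → v₁ < pₖ → ⊥
  below-132 z<vₖ v₂<z v₁<pₖ with Fin.<-cmp v₂ pₖ
  ... | tri< v₂<pₖ _ _ =
    Fin.<⇒≢ p₁<p₂ (trans (proj₁ (unique (132-at-p₁ z<vₖ v₁<pₖ))) (sym (proj₁ (unique 132-at-p₂))))
    where
    pₖ<vₖ = Fin.<-trans pₖ<z z<vₖ
    132-at-p₂ : Is132 π p₂ pₖ vₖ
    132-at-p₂ = chain-ascending (Increasing-reflects chain-ordered (Fin.<-trans v₂<pₖ pₖ<vₖ))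
              , pₖ<vₖ
              , subst (v₂ <_) (sym (inv pₖ)) v₂<pₖ , subst (_< vₖ) (sym (inv pₖ)) pₖ<vₖ
  ... | tri≈ _ v₂≡pₖ _ =
    Fin.<-irrefl (sym (π-flip v₂≡pₖ)) (ℕ.≤-<-trans (≤pₖ (suc zero)) (Fin.<-trans pₖ<z z<vₖ))
  ... | tri> _ _ pₖ<v₂ =
    Fin.<-irrefl (trans (proj₂ (proj₂ (unique 132-at-v₁)))
                        (sym (proj₂ (proj₂ (unique (132-at-p₁ z<vₖ v₁<pₖ))))))
                 (Fin.<-trans v₂<z z<vₖ)
    where
    132-at-v₁ : Is132 π v₁ pₖ v₂
    132-at-v₁ = v₁<pₖ , pₖ<v₂ , subst₂ _<_ (sym (inv p₁)) (sym (inv p₂)) p₁<p₂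
              , subst (_< vₖ) (sym (inv p₂)) (ℕ.≤-<-trans (≤pₖ (suc zero)) (Fin.<-trans pₖ<z z<vₖ))

  v₂<z-impossible : z < vₖ → v₂ < z → ⊥
  v₂<z-impossible z<vₖ v₂<z with Fin.<-cmp pₖ v₁
  ... | tri< pₖ<v₁ _ _ =
    Fin.<-irrefl (sym (last-unique (Fin.<-trans pₖ<z z<vₖ) (subst (_< v₁) (sym (inv pₖ)) pₖ<v₁)))
                 z<vₖ
  ... | tri≈ _ pₖ≡v₁ _ =
    Fin.<-irrefl (sym (π-flip (sym pₖ≡v₁))) (ℕ.≤-<-trans (≤pₖ zero) (Fin.<-trans pₖ<z z<vₖ))
  ... | tri> _ _ v₁<pₖ = below-132 z<vₖ v₂<z v₁<pₖ

  z<vₖ-impossible : w < p₁ → z < vₖ → ⊥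
  z<vₖ-impossible w<p₁ z<vₖ with Fin.<-cmp v₂ z
  ... | tri< v₂<z _ _ = v₂<z-impossible z<vₖ v₂<z
  ... | tri≈ _ v₂≡z _ = Fin.<-irrefl (π-flip v₂≡z) (Fin.<-trans w<p₁ p₁<p₂)
  ... | tri> _ _ z<v₂ = Fin.<-irrefl w≡p₁ w<p₁
    where
    w<z = w<p₁⇒w<z w<p₁

    occurrence-with-w : CycOccurrence π (updateAt p zero (const w)) z
    occurrence-with-w = record
      { chain-ascending = updateAt-increasing chain-ascending (λ _ ())
                            (λ s 0<s → Fin.<-trans w<p₁ (chain-ascending 0<s))
      ; chain-ordered   =
          Increasing-cong (sym ∘ map-updateAt-local {f = π} {g = const w} p zero (inv z))
            (updateAt-increasing chain-ordered (λ _ ())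
                                 (λ s 0<s → ℕ.<-≤-trans z<v₂ (v₂≤ s 0<s)))
      ; before-last     = updateAt-elim {t = zero} (_< z) w<z (λ s _ → before-last s)
      ; last-smallest   = updateAt-elim {t = zero} (λ y → w < π y) (subst (w <_) (sym (inv z)) w<z)
                                        (λ s _ → last-smallest s)
      }

    w≡p₁ : w ≡ p₁
    w≡p₁ = trans (sym (updateAt-updates zero p)) (chain-unique occurrence-with-w zero)

  w≮p₁ : ¬ w < p₁
  w≮p₁ w<p₁ with Fin.<-cmp vₖ z
  ... | tri< vₖ<z _ _ = fixed-chain-impossible w<p₁ (chain-unique mirror)
    where
    mirror : CycOccurrence π (π ∘ p) z
    mirror = record
      { chain-ascending = chain-ordered
      ; chain-ordered   = Increasing-cong (sym ∘ inv ∘ p) chain-ascending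
      ; before-last     = λ a → ℕ.≤-<-trans (≤vₖ a) vₖ<z
      ; last-smallest   = λ a → subst (w <_) (sym (inv (p a))) (ℕ.<-≤-trans w<p₁ (p₁≤ a))
      }
  ... | tri≈ _ vₖ≡z _ = Fin.<-irrefl (π-flip vₖ≡z) (ℕ.<-≤-trans w<p₁ (≤pₖ zero))
  ... | tri> _ _ z<vₖ = z<vₖ-impossible w<p₁ z<vₖ

  impossible : ⊥
  impossible with Fin.<-cmp p₁ w
  ... | tri< p₁<w _ _ = p₁≮w p₁<w
  ... | tri≈ _ p₁≡w _ = p₁≢w p₁≡w
  ... | tri> _ _ w<p₁ = w≮p₁ w<p₁

¬UniqueCycOccurrence-long : {π : Fin n → Fin n} → IsInvolution π → Unique132 π →
                            ¬ UniqueCycOccurrence π (suc (suc m))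
¬UniqueCycOccurrence-long inv U uc = LongCycOccurrence.impossible inv U uc

theorem3p25 : (k : ℕ) → 2 ≤ k → (n : ℕ) → (π : Fin n → Fin n)
    → IsInvolution π → IsEven (inversions π) → occurrences p132 π ≡ 1
    → (¬ occurrences (idPat k) π ≡ 1) × (¬ occurrences (cycPat k) π ≡ 1)
theorem3p25 (suc (suc k)) (s≤s (s≤s z≤n)) n π inv even once132 = no-idPat , no-cycPat k
  where
  U : Unique132 π
  U = occurrences≡1⇒Unique132 once132

  no-idPat : ¬ occurrences (idPat (suc (suc k))) π ≡ 1
  no-idPat once = ¬UniqueOccurrence-idPat inv U (occurrences≡1⇒unique {τ = idPat _} id once)

  no-cycPat : ∀ k → ¬ occurrences (cycPat (suc (suc k))) π ≡ 1
  no-cycPat zero    once =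
    even-inversions⇒¬UniqueCycOccurrence₁ even (occurrences≡1⇒UniqueCycOccurrence {π = π} once)
  no-cycPat (suc _) once =
    ¬UniqueCycOccurrence-long inv U (occurrences≡1⇒UniqueCycOccurrence {π = π} once)
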